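{- Let $f:\mathbb{Z}_+\to\mathbb{R}$ be an L-additive function which is not identically zero, and let $a,b\in\mathbb{N}=\{0,1,2,\dots\}$. Then: (i) If $p\in U_f$, then $$\Big(\frac{f(p^{a+1})}{(a+1)f(p)}\Big)^b=\Big(\frac{f(p^{b+1})}{(b+1)f(p)}\Big)^a.$$ (ii) If $p,q\in U_f$, then $$f(p^aq^b)=\frac{f(p^a)f(q^{b+1})}{(b+1)f(q)}+\frac{f(q^b)f(p^{a+1})}{(a+1)f(p)}.$$ (iii) If $p\in V_f$ and $q_1,q_2\in U_f$, then $$\frac{f(pq_1)}{f(pq_2)}=\frac{f(q_1)}{f(q_2)}\neq 0.$$ (iv) If $p\in U_f$, then $f(p^2)\neq 0$.
   Context: $\mathbb{P}$ is the set of primes. An arithmetic function $h$ is completely multiplicative if $h(1)=1$ and $h(mn)=h(m)h(n)$ for all $m,n\in\mathbb{Z}_+$. An arithmetic function $f$ is L-additive if there is a nonzero-valued completely multiplicative function $h_f$ such that $f(mn)=f(m)h_f(n)+f(n)h_f(m)$ for all $m,n\in\mathbb{Z}_+$. $U_f=\{p\in\mathbb{P}: f(p)\neq 0\}$ and $V_f=\{p\in\mathbb{P}: f(p)=0\}$. -}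

module Defs where

open import Level using (Level; _⊔_) renaming (suc to lsuc)
open import Data.Nat as ℕ using (ℕ; zero; suc; _<_)
open import Data.Nat.Primality using (Prime)
open import Data.Product using (Σ; ∃; _×_)
open import Relation.Nullary using (¬_)
open import Algebra.Bundles using (CommutativeRing)

-- A field: a commutative ring (with setoid equality ≈) together with a total
-- inverse map _⁻¹ that is a genuine inverse on nonzero elements
-- (the value of 0⁻¹ is irrelevant for the statement; we fix 0⁻¹ ≈ 0),
-- and 0 ≉ 1.
record Field (c ℓ : Level) : Set (lsuc (c ⊔ ℓ)) where
  field
    commutativeRing : CommutativeRing c ℓ
  open CommutativeRing commutativeRing public
  field
    _⁻¹      : Carrier → Carrier
    ⁻¹-cong  : ∀ {x y} → x ≈ y → x ⁻¹ ≈ y ⁻¹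
    ⁻¹-inverse : ∀ x → ¬ (x ≈ 0#) → x * (x ⁻¹) ≈ 1#
    0⁻¹      : 0# ⁻¹ ≈ 0#
    0≉1      : ¬ (0# ≈ 1#)

module _ {c ℓ : Level} (F : Field c ℓ) where
  open Field F

  infixl 7 _/_
  _/_ : Carrier → Carrier → Carrier
  x / y = x * (y ⁻¹)

  infixr 8 _^ᶠ_
  _^ᶠ_ : Carrier → ℕ → Carrier
  x ^ᶠ zero  = 1#
  x ^ᶠ suc n = x * (x ^ᶠ n)

  ι : ℕ → Carrier
  ι zero    = 0#
  ι (suc n) = 1# + ι n

  -- characteristic zero (ℝ has it)
  CharZero : Set ℓ
  CharZero = ∀ n → ¬ (ι (suc n) ≈ 0#)

  -- arithmetic functions are maps ℕ → F; only values on ℤ₊ = {n | 0 < n} matter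
  CompletelyMultiplicative : (ℕ → Carrier) → Set ℓ
  CompletelyMultiplicative h =
    h 1 ≈ 1# × (∀ m n → 0 < m → 0 < n → h (m ℕ.* n) ≈ h m * h n)

  NonzeroValued : (ℕ → Carrier) → Set ℓ
  NonzeroValued h = ∀ n → 0 < n → ¬ (h n ≈ 0#)

  LAdditive : (ℕ → Carrier) → Set (c ⊔ ℓ)
  LAdditive f = Σ (ℕ → Carrier) λ h →
    CompletelyMultiplicative h × NonzeroValued h ×
    (∀ m n → 0 < m → 0 < n → f (m ℕ.* n) ≈ f m * h n + f n * h m)

  NotIdenticallyZero : (ℕ → Carrier) → Set ℓ
  NotIdenticallyZero f = ∃ λ n → 0 < n × ¬ (f n ≈ 0#)

  U : (ℕ → Carrier) → ℕ → Set ℓ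
  U f p = Prime p × ¬ (f p ≈ 0#)

  V : (ℕ → Carrier) → ℕ → Set ℓ
  V f p = Prime p × f p ≈ 0#

{-# OPTIONS --safe #-}
-- The law f(mn) = f(m)h(n) + f(n)h(m) makes f a derivation twisted by h, so
-- f(p^(k+1)) = (k+1) f(p) h(p)^k: the normalised quotients in (i) and (ii) are
-- both just powers of h(p), and f(p²) = 2 f(p) h(p) in (iv). If f(p) = 0 the
-- law degenerates to f(pq) = f(q) h(p), and h(p) cancels in (iii).
module Submission where

open import Level using (Level)
open import Data.Nat as ℕ using (ℕ; zero; suc; _<_)
import Data.Nat.Properties as ℕ
open import Data.Nat.Primality using (Prime; prime⇒nonZero)
open import Data.Product using (_×_; _,_)
open import Relation.Nullary using (¬_)
open import Relation.Binary.PropositionalEquality as ≡ using (_≡_)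
import Algebra.Properties.CommutativeSemigroup as CommutativeSemigroupProperties
import Algebra.Properties.Semiring.Exp as SemiringExp
import Relation.Binary.Reasoning.Setoid as SetoidReasoning
open import Defs using (Field; CharZero; LAdditive; NotIdenticallyZero; U; V)
import Defs

module FieldProperties {c ℓ : Level} (F : Field c ℓ) where
  open Field F
  open SetoidReasoning setoid
  open CommutativeSemigroupProperties *-commutativeSemigroup using (interchange; xy∙z≈x∙zy)
  open SemiringExp semiring using (^-congˡ; ^-assocʳ) renaming (_^_ to _^ʳ_)

  private
    infixl 7 _/_
    _/_ : Carrier → Carrier → Carrier
    _/_ = Defs._/_ F

    infixr 8 _^ᶠ_
    _^ᶠ_ : Carrier → ℕ → Carrier
    _^ᶠ_ = Defs._^ᶠ_ F

    ι : ℕ → Carrier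
    ι = Defs.ι F

  1≉0 : 1# ≉ 0#
  1≉0 1≈0 = 0≉1 (sym 1≈0)

  *-≉0 : ∀ {x y} → x ≉ 0# → y ≉ 0# → x * y ≉ 0#
  *-≉0 {x} {y} x≉0 y≉0 xy≈0 = y≉0 (begin
    y                ≈⟨ sym (*-identityˡ y) ⟩
    1# * y           ≈⟨ *-congʳ (sym (trans (*-comm _ _) (⁻¹-inverse x x≉0))) ⟩
    (x ⁻¹ * x) * y   ≈⟨ *-assoc _ _ _ ⟩
    x ⁻¹ * (x * y)   ≈⟨ *-congˡ xy≈0 ⟩
    x ⁻¹ * 0#        ≈⟨ zeroʳ _ ⟩
    0#               ∎)

  ⁻¹-≉0 : ∀ {x} → x ≉ 0# → x ⁻¹ ≉ 0#
  ⁻¹-≉0 {x} x≉0 x⁻¹≈0 = 0≉1 (begin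
    0#          ≈⟨ sym (zeroʳ x) ⟩
    x * 0#      ≈⟨ *-congˡ (sym x⁻¹≈0) ⟩
    x * x ⁻¹    ≈⟨ ⁻¹-inverse x x≉0 ⟩
    1#          ∎)

  /-≉0 : ∀ {x y} → x ≉ 0# → y ≉ 0# → x / y ≉ 0#
  /-≉0 x≉0 y≉0 = *-≉0 x≉0 (⁻¹-≉0 y≉0)

  ⁻¹-unique : ∀ {x z} → x ≉ 0# → x * z ≈ 1# → z ≈ x ⁻¹
  ⁻¹-unique {x} {z} x≉0 xz≈1 = begin
    z                ≈⟨ sym (*-identityʳ z) ⟩
    z * 1#           ≈⟨ *-congˡ (sym (⁻¹-inverse x x≉0)) ⟩
    z * (x * x ⁻¹)   ≈⟨ sym (*-assoc _ _ _) ⟩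
    (z * x) * x ⁻¹   ≈⟨ *-congʳ (trans (*-comm z x) xz≈1) ⟩
    1# * x ⁻¹        ≈⟨ *-identityˡ _ ⟩
    x ⁻¹             ∎

  ⁻¹-distrib-* : ∀ {x y} → x ≉ 0# → y ≉ 0# → (x * y) ⁻¹ ≈ x ⁻¹ * y ⁻¹
  ⁻¹-distrib-* {x} {y} x≉0 y≉0 = sym (⁻¹-unique (*-≉0 x≉0 y≉0) (begin
    (x * y) * (x ⁻¹ * y ⁻¹)   ≈⟨ interchange _ _ _ _ ⟩
    (x * x ⁻¹) * (y * y ⁻¹)   ≈⟨ *-cong (⁻¹-inverse x x≉0) (⁻¹-inverse y y≉0) ⟩
    1# * 1#                   ≈⟨ *-identityˡ _ ⟩
    1#                        ∎))

  *-/-cancelˡ : ∀ {w} u → w ≉ 0# → (w * u) / w ≈ u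
  *-/-cancelˡ {w} u w≉0 = begin
    (w * u) * w ⁻¹   ≈⟨ *-congʳ (*-comm w u) ⟩
    (u * w) * w ⁻¹   ≈⟨ *-assoc _ _ _ ⟩
    u * (w * w ⁻¹)   ≈⟨ *-congˡ (⁻¹-inverse w w≉0) ⟩
    u * 1#           ≈⟨ *-identityʳ u ⟩
    u                ∎

  /-*-cancelʳ : ∀ u {v w} → v ≉ 0# → w ≉ 0# → (u * w) / (v * w) ≈ u / v
  /-*-cancelʳ u {v} {w} v≉0 w≉0 = begin
    (u * w) * (v * w) ⁻¹      ≈⟨ *-congˡ (⁻¹-distrib-* v≉0 w≉0) ⟩
    (u * w) * (v ⁻¹ * w ⁻¹)   ≈⟨ interchange _ _ _ _ ⟩
    (u * v ⁻¹) * (w * w ⁻¹)   ≈⟨ *-congˡ (⁻¹-inverse w w≉0) ⟩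
    (u * v ⁻¹) * 1#           ≈⟨ *-identityʳ _ ⟩
    u * v ⁻¹                  ∎

  ^ᶠ≡^ : ∀ x n → x ^ᶠ n ≡ x ^ʳ n
  ^ᶠ≡^ x zero    = ≡.refl
  ^ᶠ≡^ x (suc n) = ≡.cong (x *_) (^ᶠ≡^ x n)

  ^ᶠ-congˡ : ∀ {x y} n → x ≈ y → x ^ᶠ n ≈ y ^ᶠ n
  ^ᶠ-congˡ {x} {y} n x≈y rewrite ^ᶠ≡^ x n | ^ᶠ≡^ y n = ^-congˡ n x≈y

  ^ᶠ-comm : ∀ x m n → (x ^ᶠ m) ^ᶠ n ≈ (x ^ᶠ n) ^ᶠ m
  ^ᶠ-comm x m n rewrite ^ᶠ≡^ (x ^ᶠ m) n | ^ᶠ≡^ x m | ^ᶠ≡^ (x ^ᶠ n) m | ^ᶠ≡^ x n = begin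
    (x ^ʳ m) ^ʳ n   ≈⟨ ^-assocʳ x m n ⟩
    x ^ʳ (m ℕ.* n)  ≡⟨ ≡.cong (x ^ʳ_) (ℕ.*-comm m n) ⟩
    x ^ʳ (n ℕ.* m)    ≈⟨ ^-assocʳ x n m ⟨
    (x ^ʳ n) ^ʳ m   ∎

  module LAdditiveProperties (f h : ℕ → Carrier)
    (h-1 : h 1 ≈ 1#)
    (h-* : ∀ m n → 0 < m → 0 < n → h (m ℕ.* n) ≈ h m * h n)
    (f-* : ∀ m n → 0 < m → 0 < n → f (m ℕ.* n) ≈ f m * h n + f n * h m)
    where

    private
      ^-positive : ∀ {p} → 0 < p → ∀ n → 0 < p ℕ.^ n
      ^-positive {p} p>0 = ℕ.m^n>0 p {{ℕ.>-nonZero p>0}}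

    h-^ : ∀ {p} → 0 < p → ∀ n → h (p ℕ.^ n) ≈ h p ^ᶠ n
    h-^ p>0 zero    = h-1
    h-^ p>0 (suc n) = trans (h-* _ _ p>0 (^-positive p>0 n)) (*-congˡ (h-^ p>0 n))

    f-^-suc : ∀ {p} → 0 < p → ∀ k → f (p ℕ.^ suc k) ≈ ι (suc k) * f p * h p ^ᶠ k
    f-^-suc {p} p>0 zero = begin
      f (p ℕ.* 1)            ≡⟨ ≡.cong f (ℕ.*-identityʳ p) ⟩
      f p                    ≈⟨ sym (*-identityˡ _) ⟩
      1# * f p               ≈⟨ *-congʳ (sym (+-identityʳ 1#)) ⟩
      (1# + 0#) * f p        ≈⟨ sym (*-identityʳ _) ⟩
      (1# + 0#) * f p * 1#   ∎
    f-^-suc {p} p>0 (suc k) = begin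
      f (p ℕ.* p ℕ.^ suc k)
        ≈⟨ f-* _ _ p>0 (^-positive p>0 (suc k)) ⟩
      f p * h (p ℕ.^ suc k) + f (p ℕ.^ suc k) * h p
        ≈⟨ +-cong (*-congˡ (h-^ p>0 (suc k))) (*-congʳ (f-^-suc p>0 k)) ⟩
      f p * (H * H ^ᶠ k) + ι (suc k) * f p * H ^ᶠ k * H
        ≈⟨ +-cong (*-congʳ (sym (*-identityˡ (f p)))) (xy∙z≈x∙zy _ _ _) ⟩
      1# * f p * (H * H ^ᶠ k) + ι (suc k) * f p * (H * H ^ᶠ k)
        ≈⟨ distribʳ _ _ _ ⟨
      (1# * f p + ι (suc k) * f p) * (H * H ^ᶠ k)
        ≈⟨ *-congʳ (distribʳ _ _ _) ⟨
      (1# + ι (suc k)) * f p * (H * H ^ᶠ k)   ∎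
      where H = h p

    f-^-suc-ratio : CharZero F → ∀ {p} → 0 < p → f p ≉ 0# →
      ∀ k → f (p ℕ.^ suc k) / (ι (suc k) * f p) ≈ h p ^ᶠ k
    f-^-suc-ratio char0 p>0 fp≉0 k =
      trans (*-congʳ (f-^-suc p>0 k)) (*-/-cancelˡ _ (*-≉0 (char0 k) fp≉0))

    f-^-suc-ratio-^-comm : CharZero F → ∀ {p} → 0 < p → f p ≉ 0# → ∀ a b →
      (f (p ℕ.^ suc a) / (ι (suc a) * f p)) ^ᶠ b
        ≈ (f (p ℕ.^ suc b) / (ι (suc b) * f p)) ^ᶠ a
    f-^-suc-ratio-^-comm char0 {p} p>0 fp≉0 a b = begin
      (f (p ℕ.^ suc a) / (ι (suc a) * f p)) ^ᶠ b
        ≈⟨ ^ᶠ-congˡ b (f-^-suc-ratio char0 p>0 fp≉0 a) ⟩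
      (h p ^ᶠ a) ^ᶠ b
        ≈⟨ ^ᶠ-comm (h p) a b ⟩
      (h p ^ᶠ b) ^ᶠ a
        ≈⟨ ^ᶠ-congˡ a (f-^-suc-ratio char0 p>0 fp≉0 b) ⟨
      (f (p ℕ.^ suc b) / (ι (suc b) * f p)) ^ᶠ a   ∎

    f-^-*-^ : CharZero F → ∀ {p q} → 0 < p → 0 < q → f p ≉ 0# → f q ≉ 0# → ∀ a b →
      f (p ℕ.^ a ℕ.* q ℕ.^ b)
        ≈ f (p ℕ.^ a) * f (q ℕ.^ suc b) / (ι (suc b) * f q)
          + f (q ℕ.^ b) * f (p ℕ.^ suc a) / (ι (suc a) * f p)
    f-^-*-^ char0 {p} {q} p>0 q>0 fp≉0 fq≉0 a b = begin
      f (p ℕ.^ a ℕ.* q ℕ.^ b)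
        ≈⟨ f-* _ _ (^-positive p>0 a) (^-positive q>0 b) ⟩
      f (p ℕ.^ a) * h (q ℕ.^ b) + f (q ℕ.^ b) * h (p ℕ.^ a)
        ≈⟨ +-cong (*-congˡ (h-^ q>0 b)) (*-congˡ (h-^ p>0 a)) ⟩
      f (p ℕ.^ a) * h q ^ᶠ b + f (q ℕ.^ b) * h p ^ᶠ a
        ≈⟨ +-cong (*-congˡ (f-^-suc-ratio char0 q>0 fq≉0 b))
                  (*-congˡ (f-^-suc-ratio char0 p>0 fp≉0 a)) ⟨
      f (p ℕ.^ a) * (f (q ℕ.^ suc b) / (ι (suc b) * f q))
        + f (q ℕ.^ b) * (f (p ℕ.^ suc a) / (ι (suc a) * f p))
        ≈⟨ +-cong (*-assoc _ _ _) (*-assoc _ _ _) ⟨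
      f (p ℕ.^ a) * f (q ℕ.^ suc b) / (ι (suc b) * f q)
        + f (q ℕ.^ b) * f (p ℕ.^ suc a) / (ι (suc a) * f p)   ∎

    f-*-vanishingˡ : ∀ {p q} → 0 < p → 0 < q → f p ≈ 0# → f (p ℕ.* q) ≈ f q * h p
    f-*-vanishingˡ {p} {q} p>0 q>0 fp≈0 = begin
      f (p ℕ.* q)             ≈⟨ f-* p q p>0 q>0 ⟩
      f p * h q + f q * h p   ≈⟨ +-congʳ (trans (*-congʳ fp≈0) (zeroˡ _)) ⟩
      0# + f q * h p          ≈⟨ +-identityˡ _ ⟩
      f q * h p               ∎

    f-*-vanishingˡ-ratio : ∀ {p q₁ q₂} → 0 < p → 0 < q₁ → 0 < q₂ →
      f p ≈ 0# → h p ≉ 0# → f q₂ ≉ 0# → f (p ℕ.* q₁) / f (p ℕ.* q₂) ≈ f q₁ / f q₂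
    f-*-vanishingˡ-ratio {p} {q₁} {q₂} p>0 q₁>0 q₂>0 fp≈0 hp≉0 fq₂≉0 = begin
      f (p ℕ.* q₁) / f (p ℕ.* q₂)
        ≈⟨ *-cong (f-*-vanishingˡ p>0 q₁>0 fp≈0) (⁻¹-cong (f-*-vanishingˡ p>0 q₂>0 fp≈0)) ⟩
      (f q₁ * h p) / (f q₂ * h p)
        ≈⟨ /-*-cancelʳ _ fq₂≉0 hp≉0 ⟩
      f q₁ / f q₂   ∎

    f-^2-≉0 : CharZero F → ∀ {p} → 0 < p → h p ≉ 0# → f p ≉ 0# → f (p ℕ.^ 2) ≉ 0#
    f-^2-≉0 char0 p>0 hp≉0 fp≉0 fp²≈0 =
      *-≉0 (*-≉0 (char0 1) fp≉0) (*-≉0 hp≉0 1≉0) (trans (sym (f-^-suc p>0 1)) fp²≈0)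

open import Data.Nat using (_*_; _^_)
open Defs using (_/_; _^ᶠ_; ι)

prime⇒positive : ∀ {p} → Prime p → 0 < p
prime⇒positive {p} p-prime = ℕ.>-nonZero⁻¹ p {{prime⇒nonZero p-prime}}

theorem10 : ∀ {c ℓ : Level} (F : Field c ℓ) → CharZero F →
    (f : ℕ → Field.Carrier F) → LAdditive F f → NotIdenticallyZero F f →
    (a b : ℕ) →
    (∀ p → U F f p →
       Field._≈_ F
         (_^ᶠ_ F (_/_ F (f (p ^ suc a)) (Field._*_ F (ι F (suc a)) (f p))) b)
         (_^ᶠ_ F (_/_ F (f (p ^ suc b)) (Field._*_ F (ι F (suc b)) (f p))) a))
    × (∀ p q → U F f p → U F f q →
       Field._≈_ F
         (f ((p ^ a) * (q ^ b)))
         (Field._+_ F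
           (_/_ F (Field._*_ F (f (p ^ a)) (f (q ^ suc b))) (Field._*_ F (ι F (suc b)) (f q)))
           (_/_ F (Field._*_ F (f (q ^ b)) (f (p ^ suc a))) (Field._*_ F (ι F (suc a)) (f p)))))
    × (∀ p q₁ q₂ → V F f p → U F f q₁ → U F f q₂ →
       Field._≈_ F (_/_ F (f (p * q₁)) (f (p * q₂))) (_/_ F (f q₁) (f q₂))
       × ¬ (Field._≈_ F (_/_ F (f q₁) (f q₂)) (Field.0# F)))
    × (∀ p → U F f p → ¬ (Field._≈_ F (f (p ^ 2)) (Field.0# F)))
theorem10 F char0 f (h , (h-1 , h-*) , h≉0 , f-*) _ a b =
    (λ p (p-prime , fp≉0) →
       f-^-suc-ratio-^-comm char0 (prime⇒positive p-prime) fp≉0 a b)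
  , (λ p q (p-prime , fp≉0) (q-prime , fq≉0) →
       f-^-*-^ char0 (prime⇒positive p-prime) (prime⇒positive q-prime) fp≉0 fq≉0 a b)
  , (λ p q₁ q₂ (p-prime , fp≈0) (q₁-prime , fq₁≉0) (q₂-prime , fq₂≉0) →
       let p>0 = prime⇒positive p-prime in
         f-*-vanishingˡ-ratio p>0 (prime⇒positive q₁-prime) (prime⇒positive q₂-prime)
           fp≈0 (h≉0 p p>0) fq₂≉0
       , /-≉0 fq₁≉0 fq₂≉0)
  , (λ p (p-prime , fp≉0) →
       let p>0 = prime⇒positive p-prime in f-^2-≉0 char0 p>0 (h≉0 p p>0) fp≉0)
  where
  open FieldProperties F
  open LAdditiveProperties f h h-1 h-* f-*
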